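{- For integers $n,k\ge 0$ let $h(n,k)=\binom{2n}{n}\binom{2k}{k}\binom{n+2k}{n}\binom{n}{k}$, let $$f(x)=\sum_{n=0}^\infty\Bigl\{\sum_{k=0}^n\binom{n}{k}^4\Bigr\}x^n,$$ and let $D=x\,\frac{d}{dx}$. Then, in a neighborhood of $x=0$, $$\sum_{n=0}^\infty\sum_{k=0}^\infty h(n,k)x^{n+k}=f(x)$$ and $$\sum_{n=0}^\infty\sum_{k=0}^\infty n\,h(n,k)x^{n+k}=\frac{1}{5(1+2x)}\Bigl(4xf(x)+3(1+4x)\,Df(x)\Bigr).$$
   Context: $\binom{n}{k}=0$ for $k>n$, so $h(n,k)=0$ when $k>n$. -}

module Defs where

open import Data.Nat using (ℕ; zero; suc; _+_; _*_; _∸_; _^_)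
open import Data.Nat.Combinatorics using (_C_)

-- Formal power series with natural-number coefficients:
-- a series is its coefficient sequence  n ↦ [x^n] a.
Series : Set
Series = ℕ → ℕ

sumTo : ℕ → (ℕ → ℕ) → ℕ
sumTo zero    g = g zero
sumTo (suc m) g = sumTo m g + g (suc m)

h : ℕ → ℕ → ℕ
h n k = ((2 * n) C n) * ((2 * k) C k) * ((n + 2 * k) C n) * (n C k)

f : Series
f n = sumTo n (λ k → (n C k) ^ 4)

-- The double series  Σ_{n≥0} Σ_{k≥0} g(n,k) x^{n+k}  as a formal power series:
-- its x^m coefficient is Σ_{n+k=m} g(n,k).
doubleSeries : (ℕ → ℕ → ℕ) → Series
doubleSeries g m = sumTo m (λ n → g n (m ∸ n))

_⊕_ : Series → Series → Series
(a ⊕ b) m = a m + b m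

_⊛_ : Series → Series → Series
(a ⊛ b) m = sumTo m (λ i → a i * b (m ∸ i))

D : Series → Series
D a m = m * a m

lin : ℕ → ℕ → Series
lin a b zero          = a
lin a b (suc zero)    = b
lin a b (suc (suc _)) = 0

module Submission where

-- Both m ↦ Σₖ C(m,k)⁴ and m ↦ Σ_{n+k=m} h(n,k) satisfy
--   (m+2)³ u(m+2) = 2(2m+3)(3m²+9m+7) u(m+1) + 4(4m+3)(m+1)(4m+5) u(m)
-- and take the values 1, 2 at m = 0, 1, so they agree. Each recurrence is proved by creative
-- telescoping: applied to the summand and multiplied by a nonzero factor, the recurrence becomes a
-- difference G(m,k+1) − G(m,k), so summing over k leaves only vanishing boundary terms. All terms
-- involved are rational multiples of one hypergeometric term, so checking a certificate G amounts to
-- a polynomial identity. With T(m,k) = h(m−k,k), the second identity (coefficientwise) is a linear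
-- consequence of the first and of Σₖ [(2m+2−5k) T(m+1,k) − (2m+4+10k) T(m,k)] = 0, which is again
-- obtained by telescoping.

module Proof where

  open import Data.Nat using (ℕ; zero; suc; _∸_; _≤_; _<_; s≤s; z≤n)
    renaming (_+_ to _+ℕ_; _*_ to _*ℕ_; _^_ to _^ℕ_)
  import Data.Nat.Properties as ℕ
  open import Data.Nat.Combinatorics using (_C_; nCk+nC[k+1]≡[n+1]C[k+1]; nC1≡n; k>n⇒nCk≡0)
  open import Data.Nat.Tactic.RingSolver using () renaming (solve-∀ to ℕ-solve-∀)
  open import Data.Integer using (ℤ; +_; _+_; _*_; _-_; -_; _^_; NonZero)
  import Data.Integer.Properties as ℤ
  open import Data.Integer.Tactic.RingSolver using (solve-∀)
  open import Data.Product using (_×_; _,_; proj₁)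
  open import Data.Sum using (inj₁; inj₂)
  open import Relation.Nullary using (yes; no)
  open import Relation.Binary.PropositionalEquality
  open ≡-Reasoning
  open import Defs

  sumTo-cong : ∀ N {u v : ℕ → ℕ} → (∀ k → k ≤ N → u k ≡ v k) → sumTo N u ≡ sumTo N v
  sumTo-cong zero    u≗v = u≗v 0 z≤n
  sumTo-cong (suc N) u≗v =
    cong₂ _+ℕ_ (sumTo-cong N (λ k k≤N → u≗v k (ℕ.m≤n⇒m≤1+n k≤N))) (u≗v (suc N) ℕ.≤-refl)

  sumTo-unfoldˡ : ∀ N (u : ℕ → ℕ) → sumTo (suc N) u ≡ u 0 +ℕ sumTo N (λ i → u (suc i))
  sumTo-unfoldˡ zero    u = refl
  sumTo-unfoldˡ (suc N) u = trans (cong (_+ℕ u (suc (suc N))) (sumTo-unfoldˡ N u)) (ℕ.+-assoc (u 0) _ _)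

  sumTo-reverse : ∀ N (u : ℕ → ℕ) → sumTo N u ≡ sumTo N (λ i → u (N ∸ i))
  sumTo-reverse zero    u = refl
  sumTo-reverse (suc N) u = begin
    sumTo N u +ℕ u (suc N)                      ≡⟨ cong (_+ℕ u (suc N)) (sumTo-reverse N u) ⟩
    sumTo N (λ i → u (N ∸ i)) +ℕ u (suc N)      ≡⟨ ℕ.+-comm _ (u (suc N)) ⟩
    u (suc N) +ℕ sumTo N (λ i → u (N ∸ i))      ≡⟨ sumTo-unfoldˡ N (λ i → u (suc N ∸ i)) ⟨
    sumTo (suc N) (λ i → u (suc N ∸ i))         ∎

  sumTo-support≤1 : ∀ N (u : ℕ → ℕ) → (∀ i → u (suc (suc i)) ≡ 0) → sumTo (suc N) u ≡ u 0 +ℕ u 1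
  sumTo-support≤1 zero    u u≡0 = refl
  sumTo-support≤1 (suc N) u u≡0 =
    trans (cong₂ _+ℕ_ (sumTo-support≤1 N u u≡0) (u≡0 N)) (ℕ.+-identityʳ _)

  doubleSeries-antidiagonal : ∀ g m → doubleSeries g m ≡ sumTo m (λ k → g (m ∸ k) k)
  doubleSeries-antidiagonal g m =
    trans (sumTo-reverse m (λ n → g n (m ∸ n))) (sumTo-cong m (λ k k≤m → cong (g (m ∸ k)) (ℕ.m∸[m∸n]≡n k≤m)))

  sumToℤ : ℕ → (ℕ → ℤ) → ℤ
  sumToℤ zero    u = u zero
  sumToℤ (suc N) u = sumToℤ N u + u (suc N)

  pos-sumTo : ∀ N (u : ℕ → ℕ) → + sumTo N u ≡ sumToℤ N (λ k → + u k)
  pos-sumTo zero    u = refl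
  pos-sumTo (suc N) u = trans (ℤ.pos-+ (sumTo N u) (u (suc N))) (cong (_+ + u (suc N)) (pos-sumTo N u))

  sumToℤ-cong : ∀ N {u v : ℕ → ℤ} → (∀ k → k ≤ N → u k ≡ v k) → sumToℤ N u ≡ sumToℤ N v
  sumToℤ-cong zero    u≗v = u≗v 0 z≤n
  sumToℤ-cong (suc N) u≗v =
    cong₂ _+_ (sumToℤ-cong N (λ k k≤N → u≗v k (ℕ.m≤n⇒m≤1+n k≤N))) (u≗v (suc N) ℕ.≤-refl)

  sumToℤ-dropLast : ∀ N (u : ℕ → ℤ) → u (suc N) ≡ + 0 → sumToℤ (suc N) u ≡ sumToℤ N u
  sumToℤ-dropLast N u u≡0 = trans (cong (λ x → sumToℤ N u + x) u≡0) (ℤ.+-identityʳ (sumToℤ N u))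

  sumToℤ-+ : ∀ N (u v : ℕ → ℤ) → sumToℤ N (λ k → u k + v k) ≡ sumToℤ N u + sumToℤ N v
  sumToℤ-+ zero    u v = refl
  sumToℤ-+ (suc N) u v =
    trans (cong (_+ (u (suc N) + v (suc N))) (sumToℤ-+ N u v))
          (swap (sumToℤ N u) (sumToℤ N v) (u (suc N)) (v (suc N)))
    where
    swap : ∀ a b c d → a + b + (c + d) ≡ a + c + (b + d)
    swap = solve-∀

  sumToℤ-sub : ∀ N (u v : ℕ → ℤ) → sumToℤ N (λ k → u k - v k) ≡ sumToℤ N u - sumToℤ N v
  sumToℤ-sub zero    u v = refl
  sumToℤ-sub (suc N) u v =
    trans (cong (_+ (u (suc N) - v (suc N))) (sumToℤ-sub N u v))
          (swap (sumToℤ N u) (sumToℤ N v) (u (suc N)) (v (suc N)))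
    where
    swap : ∀ a b c d → a - b + (c - d) ≡ a + c - (b + d)
    swap = solve-∀

  sumToℤ-*ˡ : ∀ N (c : ℤ) (u : ℕ → ℤ) → sumToℤ N (λ k → c * u k) ≡ c * sumToℤ N u
  sumToℤ-*ˡ zero    c u = refl
  sumToℤ-*ˡ (suc N) c u =
    trans (cong (_+ c * u (suc N)) (sumToℤ-*ˡ N c u)) (sym (ℤ.*-distribˡ-+ c (sumToℤ N u) (u (suc N))))

  sumToℤ-telescope : ∀ N (v : ℕ → ℤ) → sumToℤ N (λ k → v (suc k) - v k) ≡ v (suc N) - v 0
  sumToℤ-telescope zero    v = refl
  sumToℤ-telescope (suc N) v =
    trans (cong (_+ (v (suc (suc N)) - v (suc N))) (sumToℤ-telescope N v))
          (cancel (v (suc N)) (v 0) (v (suc (suc N))))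
    where
    cancel : ∀ a b c → a - b + (c - a) ≡ c - b
    cancel = solve-∀

  -- Proportional integers
  -- a · x ≐ b · y states a x = b y, i.e. x : y = b : a. Ratios of hypergeometric terms are kept in
  -- this division-free form, which stays true where the terms vanish.
  infix 4 _·_≐_·_

  record _·_≐_·_ (a x b y : ℤ) : Set where
    constructor ≐-intro
    field ≐-eq : a * x ≡ b * y

  open _·_≐_·_ public

  ≐-refl : ∀ {a x} → a · x ≐ a · x
  ≐-refl = ≐-intro refl

  ≐-sym : ∀ {a x b y} → a · x ≐ b · y → b · y ≐ a · x
  ≐-sym (≐-intro e) = ≐-intro (sym e)

  ≐-cong : ∀ {a x b y a′ x′ b′ y′} → a ≡ a′ → x ≡ x′ → b ≡ b′ → y ≡ y′ → a · x ≐ b · y → a′ · x′ ≐ b′ · y′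
  ≐-cong refl refl refl refl r = r

  ≐-trans′ : ∀ {a x b y c d z} → a · x ≐ b · y → c · y ≐ d · z → c · (a * x) ≐ (b * d) · z
  ≐-trans′ {a} {x} {b} {y} {c} {d} {z} (≐-intro e₁) (≐-intro e₂) = ≐-intro (begin
    c * (a * x)  ≡⟨ cong (c *_) e₁ ⟩
    c * (b * y)  ≡⟨ swap c b y ⟩
    b * (c * y)  ≡⟨ cong (b *_) e₂ ⟩
    b * (d * z)  ≡⟨ ℤ.*-assoc b d z ⟨
    (b * d) * z  ∎)
    where
    swap : ∀ p q r → p * (q * r) ≡ q * (p * r)
    swap = solve-∀

  ≐-trans : ∀ {a x b y c d z} → a · x ≐ b · y → c · y ≐ d · z → (a * c) · x ≐ (b * d) · z
  ≐-trans {a} {x} {b} {y} {c} {d} {z} r₁ r₂ = ≐-intro (begin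
    (a * c) * x  ≡⟨ cong (_* x) (ℤ.*-comm a c) ⟩
    (c * a) * x  ≡⟨ ℤ.*-assoc c a x ⟩
    c * (a * x)  ≡⟨ ≐-eq (≐-trans′ r₁ r₂) ⟩
    (b * d) * z  ∎)

  ≐-* : ∀ {a x b y c u d v} → a · x ≐ b · y → c · u ≐ d · v → (a * c) · (x * u) ≐ (b * d) · (y * v)
  ≐-* {a} {x} {b} {y} {c} {u} {d} {v} (≐-intro e₁) (≐-intro e₂) =
    ≐-intro (trans (shuffle a c x u) (trans (cong₂ _*_ e₁ e₂) (sym (shuffle b d y v))))
    where
    shuffle : ∀ p q r s → (p * q) * (r * s) ≡ (p * r) * (q * s)
    shuffle = solve-∀

  ≐-^ : ∀ {a x b y} n → a · x ≐ b · y → (a ^ n) · (x ^ n) ≐ (b ^ n) · (y ^ n)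
  ≐-^ zero    r = ≐-refl
  ≐-^ (suc n) r = ≐-* r (≐-^ n r)

  ≐-scale : ∀ {a x b y} c → a · x ≐ b · y → (c * a) · x ≐ (c * b) · y
  ≐-scale {a} {x} {b} {y} c (≐-intro e) =
    ≐-intro (trans (ℤ.*-assoc c a x) (trans (cong (c *_) e) (sym (ℤ.*-assoc c b y))))

  ≐-rescale : ∀ {a x b y a′ b′} s f .{{_ : NonZero f}} →
              s * a ≡ f * a′ → s * b ≡ f * b′ → a · x ≐ b · y → a′ · x ≐ b′ · y
  ≐-rescale {a} {x} {b} {y} {a′} {b′} s f sa≡fa′ sb≡fb′ r =
    ≐-intro (ℤ.*-cancelˡ-≡ f (a′ * x) (b′ * y) (begin
      f * (a′ * x)  ≡⟨ ℤ.*-assoc f a′ x ⟨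
      (f * a′) * x  ≡⟨ ≐-eq (≐-cong sa≡fa′ refl sb≡fb′ refl (≐-scale s r)) ⟩
      (f * b′) * y  ≡⟨ ℤ.*-assoc f b′ y ⟩
      f * (b′ * y)  ∎))

  ≐-+ : ∀ {a x b z y c} → a · x ≐ b · z → a · y ≐ c · z → a · (x + y) ≐ (b + c) · z
  ≐-+ {a} {x} {b} {z} {y} {c} (≐-intro e₁) (≐-intro e₂) = ≐-intro (begin
    a * (x + y)     ≡⟨ ℤ.*-distribˡ-+ a x y ⟩
    a * x + a * y   ≡⟨ cong₂ _+_ e₁ e₂ ⟩
    b * z + c * z   ≡⟨ ℤ.*-distribʳ-+ z b c ⟨
    (b + c) * z     ∎)

  ≐-sub : ∀ {a x b z y c} → a · x ≐ b · z → a · y ≐ c · z → a · (x - y) ≐ (b - c) · z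
  ≐-sub {a} {x} {b} {z} {y} {c} (≐-intro e₁) (≐-intro e₂) = ≐-intro (begin
    a * (x - y)     ≡⟨ distribˡ a x y ⟩
    a * x - a * y   ≡⟨ cong₂ _-_ e₁ e₂ ⟩
    b * z - c * z   ≡⟨ distribʳ z b c ⟩
    (b - c) * z     ∎)
    where
    distribˡ : ∀ p q r → p * (q - r) ≡ p * q - p * r
    distribˡ = solve-∀
    distribʳ : ∀ p q r → q * p - r * p ≡ (q - r) * p
    distribʳ = solve-∀

  ≐-*ˡ : ∀ {a x b z} c → a · x ≐ b · z → a · (c * x) ≐ (c * b) · z
  ≐-*ˡ {a} {x} {b} {z} c (≐-intro e) = ≐-intro (begin
    a * (c * x)  ≡⟨ swap a c x ⟩
    c * (a * x)  ≡⟨ cong (c *_) e ⟩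
    c * (b * z)  ≡⟨ ℤ.*-assoc c b z ⟨
    (c * b) * z  ∎)
    where
    swap : ∀ p q r → p * (q * r) ≡ q * (p * r)
    swap = solve-∀

  ≐-unique : ∀ {a x b z y c} .{{_ : NonZero a}} → a · x ≐ b · z → a · y ≐ c · z → b ≡ c → x ≡ y
  ≐-unique {a} {x} {b} {z} {y} (≐-intro e₁) (≐-intro e₂) refl =
    ℤ.*-cancelˡ-≡ a x y (trans e₁ (sym e₂))

  -- Binomial coefficients
  absorption : ∀ n k → suc k *ℕ (suc n C suc k) ≡ suc n *ℕ (n C k)
  absorption zero    zero    = refl
  absorption zero    (suc k) = begin
    suc (suc k) *ℕ (1 C suc (suc k))  ≡⟨ cong (suc (suc k) *ℕ_) (k>n⇒nCk≡0 {1} {suc (suc k)} (s≤s (s≤s z≤n))) ⟩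
    suc (suc k) *ℕ 0                  ≡⟨ ℕ.*-zeroʳ (suc (suc k)) ⟩
    0                                 ≡⟨ cong (1 *ℕ_) (k>n⇒nCk≡0 {0} {suc k} (s≤s z≤n)) ⟨
    1 *ℕ (0 C suc k)                  ∎
  absorption (suc n) zero    = trans (ℕ.*-identityˡ _) (trans (nC1≡n (suc (suc n))) (sym (ℕ.*-identityʳ _)))
  absorption (suc n) (suc k) = begin
    (2 +ℕ k) *ℕ (suc (suc n) C suc (suc k))
      ≡⟨ cong ((2 +ℕ k) *ℕ_) (nCk+nC[k+1]≡[n+1]C[k+1] (suc n) (suc k)) ⟨
    (2 +ℕ k) *ℕ (p +ℕ q)
      ≡⟨ ℕ.*-distribˡ-+ (2 +ℕ k) p q ⟩
    p +ℕ (1 +ℕ k) *ℕ p +ℕ (2 +ℕ k) *ℕ q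
      ≡⟨ cong₂ (λ r s → p +ℕ r +ℕ s) (absorption n k) (absorption n (suc k)) ⟩
    p +ℕ (1 +ℕ n) *ℕ (n C k) +ℕ (1 +ℕ n) *ℕ (n C suc k)
      ≡⟨ ℕ.+-assoc p _ _ ⟩
    p +ℕ ((1 +ℕ n) *ℕ (n C k) +ℕ (1 +ℕ n) *ℕ (n C suc k))
      ≡⟨ cong (p +ℕ_) (ℕ.*-distribˡ-+ (1 +ℕ n) (n C k) _) ⟨
    p +ℕ (1 +ℕ n) *ℕ ((n C k) +ℕ (n C suc k))
      ≡⟨ cong (λ r → p +ℕ (1 +ℕ n) *ℕ r) (nCk+nC[k+1]≡[n+1]C[k+1] n k) ⟩
    (2 +ℕ n) *ℕ p
      ∎
    where
    p = suc n C suc k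
    q = suc n C suc (suc k)

  pascalℤ : ∀ n k → + (n C k) + + (n C suc k) ≡ + (suc n C suc k)
  pascalℤ n k = trans (sym (ℤ.pos-+ (n C k) _)) (cong +_ (nCk+nC[k+1]≡[n+1]C[k+1] n k))

  C-ratio-both : ∀ n k → (+ 1 + + n) · + (n C k) ≐ (+ 1 + + k) · + (suc n C suc k)
  C-ratio-both n k = ≐-intro (begin
    + suc n * + (n C k)              ≡⟨ ℤ.pos-* (suc n) (n C k) ⟨
    + (suc n *ℕ (n C k))             ≡⟨ cong +_ (absorption n k) ⟨
    + (suc k *ℕ (suc n C suc k))     ≡⟨ ℤ.pos-* (suc k) _ ⟩
    + suc k * + (suc n C suc k)      ∎)

  C-ratio-bottom : ∀ n k → (+ 1 + + k) · + (n C suc k) ≐ (+ n - + k) · + (n C k)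
  C-ratio-bottom n k = ≐-intro (begin
    (+ 1 + + k) * y                    ≡⟨ isolate (+ 1 + + k) x y ⟩
    (+ 1 + + k) * (x + y) - K′ * x     ≡⟨ cong (λ p → (+ 1 + + k) * p - K′ * x) (pascalℤ n k) ⟩
    (+ 1 + + k) * + (suc n C suc k) - K′ * x
                                       ≡⟨ cong (_- K′ * x) (≐-eq (C-ratio-both n k)) ⟨
    (+ 1 + + n) * x - K′ * x           ≡⟨ difference (+ n) (+ k) x ⟩
    (+ n - + k) * x                    ∎)
    where
    x = + (n C k)
    y = + (n C suc k)
    K′ = + 1 + + k
    isolate : ∀ c p q → c * q ≡ c * (p + q) - c * p
    isolate = solve-∀
    difference : ∀ n k p → (+ 1 + n) * p - (+ 1 + k) * p ≡ (n - k) * p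
    difference = solve-∀

  C-ratio-top : ∀ n k → (+ 1 + + n) · + (n C k) ≐ (+ 1 + + n - + k) · + (suc n C k)
  C-ratio-top n zero    = ≐-intro (trivial (+ n))
    where
    trivial : ∀ n → (+ 1 + n) * + 1 ≡ (+ 1 + n - + 0) * + 1
    trivial = solve-∀
  C-ratio-top n (suc k) = ≐-intro (begin
    (+ 1 + + n) * y                           ≡⟨ split (+ n) (+ k) y ⟩
    (+ 1 + + k) * y + (+ n - + k) * y         ≡⟨ cong (_+ (+ n - + k) * y) (≐-eq (C-ratio-bottom n k)) ⟩
    (+ n - + k) * x + (+ n - + k) * y         ≡⟨ ℤ.*-distribˡ-+ (+ n - + k) x y ⟨
    (+ n - + k) * (x + y)                     ≡⟨ cong₂ _*_ (shift (+ n) (+ k)) (pascalℤ n k) ⟩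
    (+ 1 + + n - (+ 1 + + k)) * + (suc n C suc k) ∎)
    where
    x = + (n C k)
    y = + (n C suc k)
    split : ∀ n k p → (+ 1 + n) * p ≡ (+ 1 + k) * p + (n - k) * p
    split = solve-∀
    shift : ∀ n k → n - k ≡ + 1 + n - (+ 1 + k)
    shift = solve-∀

  C-ratio-central : ∀ n → (+ 2 * (+ 1 + + 2 * + n)) · + ((2 *ℕ n) C n) ≐ (+ 1 + + n) · + ((2 *ℕ suc n) C suc n)
  C-ratio-central n = ≐-intro (begin
    + 2 * (+ 1 + + 2 * + n) * x            ≡⟨ cong (λ p → + 2 * (+ 1 + p) * x) two-n ⟨
    + 2 * (+ 1 + + m) * x                  ≡⟨ ℤ.*-assoc (+ 2) (+ 1 + + m) x ⟩
    + 2 * ((+ 1 + + m) * x)                ≡⟨ cong (+ 2 *_) (≐-eq (C-ratio-top m n)) ⟩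
    + 2 * ((+ 1 + + m - + n) * y)          ≡⟨ cong (λ p → + 2 * ((+ 1 + p - + n) * y)) two-n ⟩
    + 2 * ((+ 1 + + 2 * + n - + n) * y)    ≡⟨ rearrange (+ n) y ⟩
    (+ 1 + (+ 1 + + 2 * + n)) * y          ≡⟨ cong (λ p → (+ 1 + (+ 1 + p)) * y) two-n ⟨
    (+ 1 + + suc m) * y                    ≡⟨ ≐-eq (C-ratio-both (suc m) n) ⟩
    (+ 1 + + n) * + (suc (suc m) C suc n)  ≡⟨ cong (λ p → (+ 1 + + n) * + (p C suc n)) (ℕ.*-suc 2 n) ⟨
    (+ 1 + + n) * + ((2 *ℕ suc n) C suc n) ∎)
    where
    m = 2 *ℕ n
    x = + (m C n)
    y = + (suc m C n)
    two-n : + m ≡ + 2 * + n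
    two-n = ℤ.pos-* 2 n
    rearrange : ∀ n p → + 2 * ((+ 1 + + 2 * n - n) * p) ≡ (+ 1 + (+ 1 + + 2 * n)) * p
    rearrange = solve-∀

  -- The recurrence and creative telescoping
  rec₀ rec₁ rec₂ : ℤ → ℤ
  rec₀ m = + 4 * (+ 4 * m + + 3) * (+ 1 + m) * (+ 4 * m + + 5)
  rec₁ m = + 2 * (+ 2 * m + + 3) * (+ 3 * m * m + + 9 * m + + 7)
  rec₂ m = (+ 2 + m) ^ 3

  Rec : (ℕ → ℤ) → ℕ → ℤ
  Rec u m = rec₀ (+ m) * u m + rec₁ (+ m) * u (suc m) - rec₂ (+ m) * u (suc (suc m))

  Solves : (ℕ → ℤ) → Set
  Solves u = ∀ m → Rec u m ≡ + 0

  solution-unique : ∀ {u v} → Solves u → Solves v → u 0 ≡ v 0 → u 1 ≡ v 1 → ∀ m → u m ≡ v m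
  solution-unique {u} {v} su sv u₀≡v₀ u₁≡v₁ m = proj₁ (agree m)
    where
    leading : ∀ w m → Solves w → rec₂ (+ m) * w (suc (suc m)) ≡ rec₀ (+ m) * w m + rec₁ (+ m) * w (suc m)
    leading w m sw = sym (ℤ.i-j≡0⇒i≡j _ _ (sw m))
    agree : ∀ m → u m ≡ v m × u (suc m) ≡ v (suc m)
    agree zero    = u₀≡v₀ , u₁≡v₁
    agree (suc m) with agree m
    ... | eq₀ , eq₁ = eq₁ , ℤ.*-cancelˡ-≡ (rec₂ (+ m)) _ _ (begin
      rec₂ (+ m) * u (suc (suc m))                   ≡⟨ leading u m su ⟩
      rec₀ (+ m) * u m + rec₁ (+ m) * u (suc m)      ≡⟨ cong₂ (λ p q → rec₀ (+ m) * p + rec₁ (+ m) * q) eq₀ eq₁ ⟩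
      rec₀ (+ m) * v m + rec₁ (+ m) * v (suc m)      ≡⟨ leading v m sv ⟨
      rec₂ (+ m) * v (suc (suc m))                   ∎)

  telescoping-sum≡0 : ∀ N (c : ℤ) .{{_ : NonZero c}} (L G : ℕ → ℤ) →
                      (∀ k → k ≤ N → c * L k ≡ G (suc k) - G k) → G 0 ≡ + 0 → G (suc N) ≡ + 0 →
                      sumToℤ N L ≡ + 0
  telescoping-sum≡0 N c L G step G₀ G₁ = ℤ.*-cancelˡ-≡ c _ _ (begin
    c * sumToℤ N L                      ≡⟨ sumToℤ-*ˡ N c L ⟨
    sumToℤ N (λ k → c * L k)            ≡⟨ sumToℤ-cong N step ⟩
    sumToℤ N (λ k → G (suc k) - G k)    ≡⟨ sumToℤ-telescope N G ⟩
    G (suc N) - G 0                     ≡⟨ cong₂ _-_ G₁ G₀ ⟩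
    + 0                                 ≡⟨ ℤ.*-zeroʳ c ⟨
    c * + 0                             ∎)

  record Certificate (F : ℕ → ℕ → ℤ) : Set where
    field
      factor          : ℕ → ℤ
      factor-nonZero  : ∀ m → NonZero (factor m)
      G               : ℕ → ℕ → ℤ
      step            : ∀ m k → k ≤ suc (suc m) → factor m * Rec (λ n → F n k) m ≡ G m (suc k) - G m k
      G-bottom        : ∀ m → G m 0 ≡ + 0
      G-top           : ∀ m → G m (3 +ℕ m) ≡ + 0

  rowSum : (ℕ → ℕ → ℤ) → ℕ → ℤ
  rowSum F m = sumToℤ m (F m)

  solves-by-telescoping : ∀ {F} → (∀ m k → m < k → F m k ≡ + 0) → Certificate F → Solves (rowSum F)
  solves-by-telescoping {F} F-vanishes cert m = begin
    Rec (rowSum F) m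
      ≡⟨ cong₂ (λ p q → rec₀ (+ m) * p + rec₁ (+ m) * q - rec₂ (+ m) * rowSum F (2 +ℕ m)) extend₀ extend₁ ⟩
    a * Σ (F m) + b * Σ (F (1 +ℕ m)) - c * Σ (F (2 +ℕ m))
      ≡⟨ cong₂ _-_ (cong₂ _+_ (sumToℤ-*ˡ N a (F m)) (sumToℤ-*ˡ N b (F (1 +ℕ m)))) (sumToℤ-*ˡ N c (F (2 +ℕ m))) ⟨
    (Σ (λ k → a * F m k) + Σ (λ k → b * F (1 +ℕ m) k)) - Σ (λ k → c * F (2 +ℕ m) k)
      ≡⟨ cong (_- Σ (λ k → c * F (2 +ℕ m) k)) (sumToℤ-+ N _ _) ⟨
    Σ (λ k → a * F m k + b * F (1 +ℕ m) k) - Σ (λ k → c * F (2 +ℕ m) k)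
      ≡⟨ sumToℤ-sub N _ _ ⟨
    Σ (λ k → a * F m k + b * F (1 +ℕ m) k - c * F (2 +ℕ m) k)
      ≡⟨ telescoping-sum≡0 N (factor m) {{factor-nonZero m}} _ (G m) (step m) (G-bottom m) (G-top m) ⟩
    + 0 ∎
    where
    open Certificate cert
    N = 2 +ℕ m
    Σ = sumToℤ N
    a = rec₀ (+ m)
    b = rec₁ (+ m)
    c = rec₂ (+ m)
    above : ∀ n d → F n (1 +ℕ d +ℕ n) ≡ + 0
    above n d = F-vanishes n (1 +ℕ d +ℕ n) (s≤s (ℕ.m≤n+m n d))
    extend₀ : rowSum F m ≡ Σ (F m)
    extend₀ = sym (trans (sumToℤ-dropLast (1 +ℕ m) (F m) (above m 1)) (sumToℤ-dropLast m (F m) (above m 0)))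
    extend₁ : rowSum F (1 +ℕ m) ≡ Σ (F (1 +ℕ m))
    extend₁ = sym (sumToℤ-dropLast (1 +ℕ m) (F (1 +ℕ m)) (above (1 +ℕ m) 0))

  -- Fourth powers of binomial coefficients
  binomial⁴ : ℕ → ℕ → ℤ
  binomial⁴ m k = (+ (m C k)) ^ 4

  binomial⁴-vanishes : ∀ m k → m < k → binomial⁴ m k ≡ + 0
  binomial⁴-vanishes m k m<k = cong (λ x → (+ x) ^ 4) (k>n⇒nCk≡0 m<k)

  predC : ℕ → ℕ → ℕ
  predC n zero    = 0
  predC n (suc k) = n C k

  predC-absorb : ∀ n k → (+ 1 + + n) · + predC n k ≐ + k · + (suc n C k)
  predC-absorb n zero    = ≐-intro (ℤ.*-zeroʳ (+ 1 + + n))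
  predC-absorb n (suc k) = C-ratio-both n k

  -- Q, and P for h below, are Zeilberger certificates; each is verified by the polynomial identity
  -- in its step lemma.
  Q : ℤ → ℤ → ℤ
  Q m k = q₀ + k * (q₁ + k * (q₂ + k * (q₃ + k * (q₄ + k * q₅))))
    where
    q₀ = + 1080 + m * (+ 5380 + m * (+ 11330 + m * (+ 13075 + m * (+ 8930 + m * (+ 3610 + m * (+ 800 + m * + 75))))))
    q₁ = - + 2256 + m * (- + 9776 + m * (- + 17412 + m * (- + 16312 + m * (- + 8476 + m * (- + 2316 + m * - + 260)))))
    q₂ = + 1980 + m * (+ 7302 + m * (+ 10620 + m * (+ 7612 + m * (+ 2688 + m * + 374))))
    q₃ = - + 900 + m * (- + 2744 + m * (- + 3088 + m * (- + 1520 + m * - + 276)))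
    q₄ = + 210 + m * (+ 508 + m * (+ 402 + m * + 104))
    q₅ = - + 20 + m * (- + 36 + m * - + 16)

  binomial⁴-step : ∀ m k → (+ 1 + + m) ^ 4 * Rec (λ n → binomial⁴ n k) m
                           ≡ Q (+ m) (+ suc k) * binomial⁴ (suc m) k - Q (+ m) (+ k) * (+ predC (suc m) k) ^ 4
  binomial⁴-step m k = begin
    c * (p₀ * x₀ + p₁ * x₁ - p₂ * x₂)                ≡⟨ distribute c p₀ p₁ p₂ x₀ x₁ x₂ ⟩
    p₀ * (c * x₀) + (c * p₁) * x₁ - (c * p₂) * x₂
      ≡⟨ ≐-unique lhs rhs (rearrange p₀ e₀ e₁ c p₁ p₂ d (Q (+ m) (+ k)) (Q (+ m) (+ suc k)) ((+ k) ^ 4) (identity (+ m) (+ k))) ⟩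
    Q (+ m) (+ suc k) * x₁ - Q (+ m) (+ k) * w       ∎
    where
    c = (+ 1 + + m) ^ 4
    p₀ = rec₀ (+ m)
    p₁ = rec₁ (+ m)
    p₂ = rec₂ (+ m)
    x₀ = binomial⁴ m k
    x₁ = binomial⁴ (suc m) k
    x₂ = binomial⁴ (suc (suc m)) k
    w = (+ predC (suc m) k) ^ 4
    e₀ = (+ 1 + + m - + k) ^ 4
    e₁ = (+ 1 + + suc m - + k) ^ 4
    d = (+ 1 + + suc m) ^ 4
    r₀₁ = ≐-^ 4 (C-ratio-top m k)
    r₁₂ = ≐-^ 4 (C-ratio-top (suc m) k)
    lhs = ≐-sub (≐-+ (≐-*ˡ p₀ (≐-trans′ r₀₁ r₁₂)) (≐-*ˡ (c * p₁) r₁₂)) (≐-*ˡ (c * p₂) ≐-refl)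
    rhs = ≐-sub (≐-*ˡ (Q (+ m) (+ suc k)) r₁₂) (≐-*ˡ (Q (+ m) (+ k)) (≐-^ 4 (predC-absorb (suc m) k)))
    distribute : ∀ c p₀ p₁ p₂ x₀ x₁ x₂ → c * (p₀ * x₀ + p₁ * x₁ - p₂ * x₂) ≡ p₀ * (c * x₀) + (c * p₁) * x₁ - (c * p₂) * x₂
    distribute = solve-∀
    -- identity is stated with the common factor e₁ pulled out, which the ring solver
    -- normalises many times faster than the expanded equation.
    rearrange : ∀ p₀ e₀ e₁ c p₁ p₂ d Q₀ Q₁ w → (p₀ * e₀ + c * p₁ - Q₁) * e₁ - c * p₂ * d + Q₀ * w ≡ + 0 →
                p₀ * (e₀ * e₁) + (c * p₁) * e₁ - (c * p₂) * d ≡ Q₁ * e₁ - Q₀ * w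
    rearrange p₀ e₀ e₁ c p₁ p₂ d Q₀ Q₁ w eq = ℤ.i-j≡0⇒i≡j _ _ (trans (difference p₀ e₀ e₁ c p₁ p₂ d Q₀ Q₁ w) eq)
      where
      difference : ∀ p₀ e₀ e₁ c p₁ p₂ d Q₀ Q₁ w →
                   p₀ * (e₀ * e₁) + (c * p₁) * e₁ - (c * p₂) * d - (Q₁ * e₁ - Q₀ * w)
                   ≡ (p₀ * e₀ + c * p₁ - Q₁) * e₁ - c * p₂ * d + Q₀ * w
      difference = solve-∀
    identity : ∀ m k → ((+ 4 * (+ 4 * m + + 3) * (+ 1 + m) * (+ 4 * m + + 5)) * ((+ 1 + m - k) * ((+ 1 + m - k) * ((+ 1 + m - k) * ((+ 1 + m - k) * + 1)))) + ((+ 1 + m) * ((+ 1 + m) * ((+ 1 + m) * ((+ 1 + m) * + 1)))) * (+ 2 * (+ 2 * m + + 3) * (+ 3 * m * m + + 9 * m + + 7)) - ((+ 1080 + m * (+ 5380 + m * (+ 11330 + m * (+ 13075 + m * (+ 8930 + m * (+ 3610 + m * (+ 800 + m * (+ 75)))))))) + (+ 1 + k) * ((- + 2256 + m * (- + 9776 + m * (- + 17412 + m * (- + 16312 + m * (- + 8476 + m * (- + 2316 + m * (- + 260))))))) + (+ 1 + k) * ((+ 1980 + m * (+ 7302 + m * (+ 10620 + m * (+ 7612 + m * (+ 2688 + m * (+ 374)))))) + (+ 1 + k) * ((- + 900 + m * (- + 2744 + m * (- + 3088 + m * (- + 1520 + m * (- + 276))))) + (+ 1 + k) * ((+ 210 +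 m * (+ 508 + m * (+ 402 + m * (+ 104)))) + (+ 1 + k) * (- + 20 + m * (- + 36 + m * (- + 16))))))))) * ((+ 1 + (+ 1 + m) - k) * ((+ 1 + (+ 1 + m) - k) * ((+ 1 + (+ 1 + m) - k) * ((+ 1 + (+ 1 + m) - k) * + 1)))) - ((+ 1 + m) * ((+ 1 + m) * ((+ 1 + m) * ((+ 1 + m) * + 1)))) * ((+ 2 + m) * ((+ 2 + m) * ((+ 2 + m) * + 1))) * ((+ 1 + (+ 1 + m)) * ((+ 1 + (+ 1 + m)) * ((+ 1 + (+ 1 + m)) * ((+ 1 + (+ 1 + m)) * + 1)))) + ((+ 1080 + m * (+ 5380 + m * (+ 11330 + m * (+ 13075 + m * (+ 8930 + m * (+ 3610 + m * (+ 800 + m * (+ 75)))))))) + k * ((- + 2256 + m * (- + 9776 + m * (- + 17412 + m * (- + 16312 + m * (- + 8476 + m * (- + 2316 + m * (- + 260))))))) + k * ((+ 1980 + m * (+ 7302 + m * (+ 10620 + m * (+ 7612 + m * (+ 2688 + m * (+ 374)))))) + k * ((- + 900 + m * (- + 2744 + m * (- + 3088 + m * (- + 1520 + m * (- + 276))))) + k * ((+ 210 + m * (+ 508 + m * (+ 402 + m * (+ 104)))) + k * (- + 20 + m * (- + 36 + m * (- + 16)))))))) * (k * (k * (k * (k * + 1)))) ≡ + 0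
    identity = solve-∀

  binomial⁴-certificate : Certificate binomial⁴
  binomial⁴-certificate = record
    { factor         = λ m → (+ 1 + + m) ^ 4
    ; factor-nonZero = λ m → _
    ; G              = λ m k → Q (+ m) (+ k) * (+ predC (suc m) k) ^ 4
    ; step           = λ m k _ → binomial⁴-step m k
    ; G-bottom       = λ m → ℤ.*-zeroʳ (Q (+ m) (+ 0))
    ; G-top          = λ m → trans (cong (λ x → Q (+ m) (+ (3 +ℕ m)) * (+ x) ^ 4) (k>n⇒nCk≡0 (ℕ.n<1+n (suc m))))
                                   (ℤ.*-zeroʳ (Q (+ m) (+ (3 +ℕ m))))
    }

  binomial⁴-solves : Solves (rowSum binomial⁴)
  binomial⁴-solves = solves-by-telescoping binomial⁴-vanishes binomial⁴-certificate

  pos-^ : ∀ x n → + (x ^ℕ n) ≡ (+ x) ^ n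
  pos-^ x zero    = refl
  pos-^ x (suc n) = trans (ℤ.pos-* x (x ^ℕ n)) (cong (+ x *_) (pos-^ x n))

  f≡rowSum-binomial⁴ : ∀ m → + f m ≡ rowSum binomial⁴ m
  f≡rowSum-binomial⁴ m = trans (pos-sumTo m _) (sumToℤ-cong m (λ k _ → pos-^ (m C k) 4))

  -- Antidiagonal sums of h
  hTerm : ℕ → ℕ → ℕ → ℕ → ℤ
  hTerm n k a b = + ((2 *ℕ n) C n) * + ((2 *ℕ k) C k) * + (a C b) * + (n C k)

  hℤ : ℕ → ℕ → ℤ
  hℤ n k = hTerm n k (n +ℕ 2 *ℕ k) n

  pos-h : ∀ n k → + h n k ≡ hℤ n k
  pos-h n k = begin
    + (c₁ *ℕ c₂ *ℕ c₃ *ℕ c₄)          ≡⟨ ℤ.pos-* (c₁ *ℕ c₂ *ℕ c₃) c₄ ⟩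
    + (c₁ *ℕ c₂ *ℕ c₃) * + c₄         ≡⟨ cong (_* + c₄) (ℤ.pos-* (c₁ *ℕ c₂) c₃) ⟩
    + (c₁ *ℕ c₂) * + c₃ * + c₄        ≡⟨ cong (λ p → p * + c₃ * + c₄) (ℤ.pos-* c₁ c₂) ⟩
    + c₁ * + c₂ * + c₃ * + c₄         ∎
    where
    c₁ = (2 *ℕ n) C n
    c₂ = (2 *ℕ k) C k
    c₃ = (n +ℕ 2 *ℕ k) C n
    c₄ = n C k

  h-antidiagonal : ℕ → ℕ → ℤ
  h-antidiagonal m k = hℤ (m ∸ k) k

  pos-+2* : ∀ n k → + (n +ℕ 2 *ℕ k) ≡ + n + + 2 * + k
  pos-+2* n k = trans (ℤ.pos-+ n (2 *ℕ k)) (cong (λ p → + n + p) (ℤ.pos-* 2 k))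

  hTerm-vanishes : ∀ n k a b → n < k → hTerm n k a b ≡ + 0
  hTerm-vanishes n k a b n<k =
    trans (cong (λ x → + ((2 *ℕ n) C n) * + ((2 *ℕ k) C k) * + (a C b) * + x) (k>n⇒nCk≡0 n<k))
          (ℤ.*-zeroʳ (+ ((2 *ℕ n) C n) * + ((2 *ℕ k) C k) * + (a C b)))

  h-antidiagonal-vanishes : ∀ m k → m < k +ℕ k → h-antidiagonal m k ≡ + 0
  h-antidiagonal-vanishes m (suc k) m<2k =
    hTerm-vanishes (m ∸ suc k) (suc k) (m ∸ suc k +ℕ 2 *ℕ suc k) (m ∸ suc k) (ℕ.m<n+o⇒m∸n<o m (suc k) m<2k)

  <-double : ∀ {m k} → m < k → m < k +ℕ k
  <-double {m} {k} m<k = ℕ.<-≤-trans m<k (ℕ.m≤m+n k k)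

  n<n+n : ∀ n → 0 < n → n < n +ℕ n
  n<n+n n 0<n = ℕ.m<m+n n 0<n

  hDen hNum : ℤ → ℤ → ℤ
  hDen n k = + 2 * (+ 1 + + 2 * n) * (+ 1 + n + + 2 * k)
  hNum n k = (+ 1 + n) * (+ 1 + n - k)

  nonZero-odd : ∀ n → NonZero (+ 1 + + 2 * + n)
  nonZero-odd n = subst NonZero (cong (λ p → + 1 + p) (ℤ.pos-* 2 n)) _

  nonZero-hDen : ∀ n k → NonZero (hDen (+ n) (+ k))
  nonZero-hDen n k = ℤ.i*j≢0 (+ 2 * (+ 1 + + 2 * + n)) (+ 1 + + n + + 2 * + k)
                     {{ℤ.i*j≢0 (+ 2) (+ 1 + + 2 * + n) {{_}} {{nonZero-odd n}}}}
                     {{subst NonZero (cong (λ p → + 1 + + n + p) (ℤ.pos-* 2 k)) _}}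

  h-ratio : ∀ n k → hDen (+ n) (+ k) · hℤ n k ≐ hNum (+ n) (+ k) · hℤ (suc n) k
  h-ratio n k = ≐-rescale (+ 1) (+ 1 + + n) (denominators (+ n) (+ k)) (numerators (+ n) (+ k))
    (≐-* (≐-* (≐-* (C-ratio-central n) (≐-refl {+ 1})) third) (C-ratio-top n k))
    where
    third : (+ 1 + (+ n + + 2 * + k)) · + ((n +ℕ 2 *ℕ k) C n) ≐ (+ 1 + + n) · + (suc (n +ℕ 2 *ℕ k) C suc n)
    third = ≐-cong (cong (λ p → + 1 + p) (pos-+2* n k)) refl refl refl (C-ratio-both (n +ℕ 2 *ℕ k) n)
    denominators : ∀ n k → + 1 * (+ 2 * (+ 1 + + 2 * n) * + 1 * (+ 1 + (n + + 2 * k)) * (+ 1 + n))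
                  ≡ (+ 1 + n) * (+ 2 * (+ 1 + + 2 * n) * (+ 1 + n + + 2 * k))
    denominators = solve-∀
    numerators : ∀ n k → + 1 * ((+ 1 + n) * + 1 * (+ 1 + n) * (+ 1 + n - k)) ≡ (+ 1 + n) * ((+ 1 + n) * (+ 1 + n - k))
    numerators = solve-∀

  hDen₂ : ℤ → ℤ → ℤ
  hDen₂ j k = hDen j k * hDen (+ 1 + j) k

  nonZero-hDen₂ : ∀ j k → NonZero (hDen₂ (+ j) (+ k))
  nonZero-hDen₂ j k = ℤ.i*j≢0 (hDen (+ j) (+ k)) (hDen (+ suc j) (+ k)) {{nonZero-hDen j k}} {{nonZero-hDen (suc j) k}}

  Y₁ : ℕ → ℕ → ℤ
  Y₁ m zero    = + 0
  Y₁ m (suc r) = (+ 1 + + m) * hTerm (m ∸ r) r (suc (m +ℕ r)) (suc (m ∸ r))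

  Y₁-shape₀ : ∀ j r → Y₁ (j +ℕ suc r) (suc r) ≡ (+ 1 + (+ j + + suc r)) * hTerm (suc j) r (j +ℕ 2 *ℕ suc r) (suc (suc j))
  Y₁-shape₀ j r = cong₂ (λ n a → (+ 1 + (+ j + + suc r)) * hTerm n r a (suc n)) j+1+r∸r≡1+j (shape j r)
    where
    j+1+r∸r≡1+j : j +ℕ suc r ∸ r ≡ suc j
    j+1+r∸r≡1+j = trans (cong (_∸ r) (ℕ.+-suc j r)) (ℕ.m+n∸n≡m (suc j) r)
    shape : ∀ j r → suc (j +ℕ suc r +ℕ r) ≡ j +ℕ 2 *ℕ suc r
    shape = ℕ-solve-∀

  Y₁-shape₁ : ∀ j k → Y₁ (j +ℕ k) (suc k) ≡ (+ 1 + (+ j + + k)) * hTerm j k (suc (j +ℕ 2 *ℕ k)) (suc j)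
  Y₁-shape₁ j k = cong₂ (λ n a → (+ 1 + (+ j + + k)) * hTerm n k (suc a) (suc n)) (ℕ.m+n∸n≡m j k) (shape j k)
    where
    shape : ∀ j k → j +ℕ k +ℕ k ≡ j +ℕ 2 *ℕ k
    shape = ℕ-solve-∀

  Y₁-vanishes : ∀ m r → m < r +ℕ r → Y₁ m (suc r) ≡ + 0
  Y₁-vanishes m (suc r) m<2r =
    trans (cong ((+ 1 + + m) *_) (hTerm-vanishes (m ∸ suc r) (suc r) (suc (m +ℕ suc r)) (suc (m ∸ suc r)) (ℕ.m<n+o⇒m∸n<o m (suc r) m<2r))) (ℤ.*-zeroʳ (+ 1 + + m))

  yNum₀ yNum₁ : ℤ → ℤ → ℤ
  yNum₀ j k = + 2 * (+ 1 + + 2 * j) * (k * k * k) * (+ 1 + j + k)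
  yNum₁ j k = (+ 1 + j + + 2 * k) * (+ 2 + j) * (+ 2 + j - k) * (+ 1 + j - k) * (+ 1 + j + k)

  Y₁-ratio₀ : ∀ j k → hDen₂ (+ j) (+ k) · Y₁ (j +ℕ k) k ≐ yNum₀ (+ j) (+ k) · hℤ (suc (suc j)) k
  Y₁-ratio₀ j zero    = ≐-intro (vanish (hDen₂ (+ j) (+ 0)) (+ j) (hℤ (suc (suc j)) 0))
    where
    vanish : ∀ d j x → d * + 0 ≡ (+ 2 * (+ 1 + + 2 * j) * (+ 0 * + 0 * + 0) * (+ 1 + j + + 0)) * x
    vanish = solve-∀
  Y₁-ratio₀ j (suc r) = ≐-cong refl (sym (Y₁-shape₀ j r)) refl refl
    (≐-rescale (+ 1 + + 2 * + j) ((+ 1 + + 2 * + r) * (+ 1 + + suc j)) {{ℤ.i*j≢0 (+ 1 + + 2 * + r) (+ 1 + + suc j) {{nonZero-odd r}}}}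
      (denominators (+ j) (+ r)) (numerators (+ j) (+ r))
      (≐-*ˡ (+ 1 + (+ j + + suc r)) (≐-* (≐-* (≐-* (C-ratio-central (suc j)) (C-ratio-central r)) third) (C-ratio-both (suc j) r))))
    where
    N = j +ℕ 2 *ℕ suc r
    third : (+ 1 + (+ j + + 2 * + suc r)) * (+ 1 + (+ 1 + (+ j + + 2 * + suc r))) · + (N C suc (suc j))
            ≐ (+ 1 + (+ j + + 2 * + suc r) - + suc (suc j)) * (+ 1 + (+ 1 + (+ j + + 2 * + suc r)) - + suc (suc j))
              · + (suc (suc N) C suc (suc j))
    third = ≐-cong (cong (λ p → (+ 1 + p) * (+ 1 + (+ 1 + p))) (pos-+2* j (suc r))) refl
                   (cong (λ p → (+ 1 + p - + suc (suc j)) * (+ 1 + (+ 1 + p) - + suc (suc j))) (pos-+2* j (suc r))) refl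
                   (≐-trans (C-ratio-top N (suc (suc j))) (C-ratio-top (suc N) (suc (suc j))))
    denominators : ∀ j r → (+ 1 + + 2 * j) * (+ 2 * (+ 1 + + 2 * (+ 1 + j)) * (+ 2 * (+ 1 + + 2 * r)) * ((+ 1 + (j + + 2 * (+ 1 + r))) * (+ 1 + (+ 1 + (j + + 2 * (+ 1 + r))))) * (+ 1 + (+ 1 + j)))
                  ≡ (+ 1 + + 2 * r) * (+ 1 + (+ 1 + j)) * ((+ 2 * (+ 1 + + 2 * j) * (+ 1 + j + + 2 * (+ 1 + r))) * (+ 2 * (+ 1 + + 2 * (+ 1 + j)) * (+ 1 + (+ 1 + j) + + 2 * (+ 1 + r))))
    denominators = solve-∀
    numerators : ∀ j r → (+ 1 + + 2 * j) * ((+ 1 + (j + (+ 1 + r))) * ((+ 1 + (+ 1 + j)) * (+ 1 + r) * ((+ 1 + (j + + 2 * (+ 1 + r)) - (+ 1 + (+ 1 + j))) * (+ 1 + (+ 1 + (j + + 2 * (+ 1 + r))) - (+ 1 + (+ 1 + j)))) * (+ 1 + r)))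
                  ≡ (+ 1 + + 2 * r) * (+ 1 + (+ 1 + j)) * (+ 2 * (+ 1 + + 2 * j) * ((+ 1 + r) * (+ 1 + r) * (+ 1 + r)) * (+ 1 + j + (+ 1 + r)))
    numerators = solve-∀

  Y₁-ratio₁ : ∀ j k → hDen₂ (+ j) (+ k) · (+ 1 + (+ j + + k)) * hTerm j k (suc (j +ℕ 2 *ℕ k)) (suc j)
                     ≐ yNum₁ (+ j) (+ k) · hℤ (suc (suc j)) k
  Y₁-ratio₁ j k = ≐-rescale (+ 1 + + j + + 2 * + k) ((+ 1 + + j) * (+ 1 + + suc j)) (denominators (+ j) (+ k)) (numerators (+ j) (+ k))
    (≐-*ˡ (+ 1 + (+ j + + k)) (≐-* (≐-* (≐-* central (≐-refl {+ 1})) third) down))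
    where
    central = ≐-trans (C-ratio-central j) (C-ratio-central (suc j))
    third : (+ 1 + (+ 1 + (+ j + + 2 * + k))) · + (suc (j +ℕ 2 *ℕ k) C suc j)
            ≐ (+ 1 + + suc j) · + (suc (suc (j +ℕ 2 *ℕ k)) C suc (suc j))
    third = ≐-cong (cong (λ p → + 1 + (+ 1 + p)) (pos-+2* j k)) refl refl refl (C-ratio-both (suc (j +ℕ 2 *ℕ k)) (suc j))
    down = ≐-trans (C-ratio-top j k) (C-ratio-top (suc j) k)
    denominators : ∀ j k → (+ 1 + j + + 2 * k) * (+ 2 * (+ 1 + + 2 * j) * (+ 2 * (+ 1 + + 2 * (+ 1 + j))) * + 1 * (+ 1 + (+ 1 + (j + + 2 * k))) * ((+ 1 + j) * (+ 1 + (+ 1 + j))))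
                  ≡ (+ 1 + j) * (+ 1 + (+ 1 + j)) * ((+ 2 * (+ 1 + + 2 * j) * (+ 1 + j + + 2 * k)) * (+ 2 * (+ 1 + + 2 * (+ 1 + j)) * (+ 1 + (+ 1 + j) + + 2 * k)))
    denominators = solve-∀
    numerators : ∀ j k → (+ 1 + j + + 2 * k) * ((+ 1 + (j + k)) * ((+ 1 + j) * (+ 1 + (+ 1 + j)) * + 1 * (+ 1 + (+ 1 + j)) * ((+ 1 + j - k) * (+ 1 + (+ 1 + j) - k))))
                  ≡ (+ 1 + j) * (+ 1 + (+ 1 + j)) * ((+ 1 + j + + 2 * k) * (+ 2 + j) * (+ 2 + j - k) * (+ 1 + j - k) * (+ 1 + j + k))
    numerators = solve-∀

  P : ℤ → ℤ → ℤ
  P m k = + 4 * (+ 86 - + 78 * k + + 16 * k * k + + 171 * m - + 106 * m * k + + 12 * m * k * k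
                  + + 112 * m * m - + 36 * m * m * k + + 24 * m * m * m)

  G₁ : ℕ → ℕ → ℤ
  G₁ m k = P (+ m) (+ k) * Y₁ m k

  HStep : ℕ → ℕ → Set
  HStep m k = (+ 1 + + m) * Rec (λ n → h-antidiagonal n k) m ≡ G₁ m (suc k) - G₁ m k

  h-step : ∀ j k → HStep (j +ℕ k) k
  h-step j k = begin
    c * (p₀ * h-antidiagonal m k + p₁ * h-antidiagonal (suc m) k - p₂ * h-antidiagonal (suc (suc m)) k)
      ≡⟨ cong₃ (λ a b d → c * (p₀ * a + p₁ * b - p₂ * d)) (on-row 0) (on-row 1) (on-row 2) ⟩
    c * (p₀ * hℤ j k + p₁ * hℤ (suc j) k - p₂ * hℤ (suc (suc j)) k)
      ≡⟨ ≐-unique {{nonZero-hDen₂ j k}} lhs rhs (identity (+ j) (+ k)) ⟩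
    P (+ m) (+ suc k) * Y₁ m (suc k) - P (+ m) (+ k) * Y₁ m k
      ∎
    where
    m = j +ℕ k
    c = + 1 + + m
    p₀ = rec₀ (+ m)
    p₁ = rec₁ (+ m)
    p₂ = rec₂ (+ m)
    cong₃ : ∀ (f : ℤ → ℤ → ℤ → ℤ) {a a′ b b′ d d′} → a ≡ a′ → b ≡ b′ → d ≡ d′ → f a b d ≡ f a′ b′ d′
    cong₃ f refl refl refl = refl
    on-row : ∀ i → h-antidiagonal (i +ℕ m) k ≡ hℤ (i +ℕ j) k
    on-row i = cong (λ n → hℤ n k) (trans (cong (_∸ k) (sym (ℕ.+-assoc i j k))) (ℕ.m+n∸n≡m (i +ℕ j) k))
    lhs = ≐-*ˡ c (≐-sub (≐-+ (≐-*ˡ p₀ (≐-trans (h-ratio j k) (h-ratio (suc j) k)))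
                            (≐-*ˡ p₁ (≐-scale (hDen (+ j) (+ k)) (h-ratio (suc j) k))))
                      (≐-*ˡ p₂ ≐-refl))
    rhs = ≐-sub (≐-*ˡ (P (+ m) (+ suc k)) (≐-cong refl (sym (Y₁-shape₁ j k)) refl refl (Y₁-ratio₁ j k)))
              (≐-*ˡ (P (+ m) (+ k)) (Y₁-ratio₀ j k))
    identity : ∀ j k → (+ 1 + (j + k)) * ((+ 4 * (+ 4 * (j + k) + + 3) * (+ 1 + (j + k)) * (+ 4 * (j + k) + + 5)) * (((+ 1 + j) * (+ 1 + j - k)) * ((+ 1 + (+ 1 + j)) * (+ 1 + (+ 1 + j) - k))) + (+ 2 * (+ 2 * (j + k) + + 3) * (+ 3 * (j + k) * (j + k) + + 9 * (j + k) + + 7)) * ((+ 2 * (+ 1 + + 2 * j) * (+ 1 + j + + 2 * k)) * ((+ 1 + (+ 1 + j)) * (+ 1 + (+ 1 + j) - k))) - ((+ 2 + (j + k)) * ((+ 2 + (j + k)) * ((+ 2 + (j + k)) * + 1))) * ((+ 2 * (+ 1 + + 2 * j) * (+ 1 + j + + 2 * k)) * (+ 2 * (+ 1 + + 2 * (+ 1 + j)) * (+ 1 + (+ 1 + j) + + 2 * k))))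
                      ≡ (+ 4 * (+ 86 - + 78 * (+ 1 + k) + + 16 * (+ 1 + k) * (+ 1 + k) + + 171 * (j + k) - + 106 * (j + k) * (+ 1 + k) + + 12 * (j + k) * (+ 1 + k) * (+ 1 + k) + + 112 * (j + k) * (j + k) - + 36 * (j + k) * (j + k) * (+ 1 + k) + + 24 * (j + k) * (j + k) * (j + k))) * ((+ 1 + j + + 2 * k) * (+ 2 + j) * (+ 2 + j - k) * (+ 1 + j - k) * (+ 1 + j + k)) - (+ 4 * (+ 86 - + 78 * k + + 16 * k * k + + 171 * (j + k) - + 106 * (j + k) * k + + 12 * (j + k) * k * k + + 112 * (j + k) * (j + k) - + 36 * (j + k) * (j + k) * k + + 24 * (j + k) * (j + k) * (j + k))) * (+ 2 * (+ 1 + + 2 * j) * (k * k * k) * (+ 1 + j + k))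
    identity = solve-∀

  HStep-vanishing : ∀ m k → h-antidiagonal m k ≡ + 0 → h-antidiagonal (suc m) k ≡ + 0 → h-antidiagonal (suc (suc m)) k ≡ + 0 →
                    Y₁ m (suc k) ≡ + 0 → Y₁ m k ≡ + 0 → HStep m k
  HStep-vanishing m k a≡0 b≡0 d≡0 y₁≡0 y₀≡0 rewrite a≡0 | b≡0 | d≡0 | y₁≡0 | y₀≡0 =
    zeros (+ 1 + + m) (rec₀ (+ m)) (rec₁ (+ m)) (rec₂ (+ m)) (P (+ m) (+ suc k)) (P (+ m) (+ k))
    where
    zeros : ∀ c p₀ p₁ p₂ q₁ q₀ → c * (p₀ * + 0 + p₁ * + 0 - p₂ * + 0) ≡ q₁ * + 0 - q₀ * + 0
    zeros = solve-∀

  h-boundary₁ : ∀ m → HStep m (suc m)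
  -- m = 0, k = 1 is the only boundary case whose terms do not all vanish; it is checked by evaluation.
  h-boundary₁ zero    = refl
  h-boundary₁ (suc m) = HStep-vanishing (suc m) (2 +ℕ m)
    (h-antidiagonal-vanishes (suc m) (2 +ℕ m) (<-double (ℕ.n<1+n (suc m))))
    (h-antidiagonal-vanishes (2 +ℕ m) (2 +ℕ m) (n<n+n (suc (suc m)) (s≤s z≤n)))
    (h-antidiagonal-vanishes (3 +ℕ m) (2 +ℕ m) (s≤s (s≤s (ℕ.m≤n+m (suc (suc m)) m))))
    (Y₁-vanishes (suc m) (2 +ℕ m) (<-double (ℕ.n<1+n (suc m))))
    (Y₁-vanishes (suc m) (suc m) (n<n+n (suc m) (s≤s z≤n)))

  h-boundary₂ : ∀ m → HStep m (suc (suc m))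
  h-boundary₂ m = HStep-vanishing m (2 +ℕ m)
    (h-antidiagonal-vanishes m (2 +ℕ m) (<-double (ℕ.m<n⇒m<1+n (ℕ.n<1+n m))))
    (h-antidiagonal-vanishes (suc m) (2 +ℕ m) (<-double (ℕ.n<1+n (suc m))))
    (h-antidiagonal-vanishes (2 +ℕ m) (2 +ℕ m) (n<n+n (suc (suc m)) (s≤s z≤n)))
    (Y₁-vanishes m (2 +ℕ m) (<-double (ℕ.m<n⇒m<1+n (ℕ.n<1+n m))))
    (Y₁-vanishes m (suc m) (<-double (ℕ.n<1+n m)))

  h-certificate-step : ∀ m k → k ≤ suc (suc m) → HStep m k
  h-certificate-step m k k≤2+m with k ℕ.≤? m
  ... | yes k≤m = subst (λ n → HStep n k) (ℕ.m∸n+n≡m k≤m) (h-step (m ∸ k) k)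
  ... | no  k≰m with ℕ.m≤n⇒m<n∨m≡n k≤2+m
  ...   | inj₂ refl  = h-boundary₂ m
  ...   | inj₁ k<2+m = subst (HStep m) (ℕ.≤-antisym (ℕ.≰⇒> k≰m) (ℕ.≤-pred k<2+m)) (h-boundary₁ m)

  h-certificate : Certificate h-antidiagonal
  h-certificate = record
    { factor         = λ m → + 1 + + m
    ; factor-nonZero = λ m → _
    ; G              = G₁
    ; step           = h-certificate-step
    ; G-bottom       = λ m → ℤ.*-zeroʳ (P (+ m) (+ 0))
    ; G-top          = λ m → trans (cong (P (+ m) (+ (3 +ℕ m)) *_) (Y₁-vanishes m (2 +ℕ m) (<-double (ℕ.m<n⇒m<1+n (ℕ.n<1+n m)))))
                                   (ℤ.*-zeroʳ (P (+ m) (+ (3 +ℕ m))))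
    }

  h-antidiagonal-solves : Solves (rowSum h-antidiagonal)
  h-antidiagonal-solves = solves-by-telescoping (λ m k m<k → h-antidiagonal-vanishes m k (<-double m<k)) h-certificate

  -- A first-order relation for the weighted antidiagonal sums
  Y₂ : ℕ → ℕ → ℤ
  Y₂ m k = hTerm (suc m ∸ k) k (m +ℕ k) (suc m ∸ k)

  Y₂-shape₀ : ∀ j k → Y₂ (j +ℕ k) k ≡ hTerm (suc j) k (j +ℕ 2 *ℕ k) (suc j)
  Y₂-shape₀ j k = cong₂ (λ n a → hTerm n k a n) (ℕ.m+n∸n≡m (suc j) k) (shape j k)
    where
    shape : ∀ j k → j +ℕ k +ℕ k ≡ j +ℕ 2 *ℕ k
    shape = ℕ-solve-∀

  Y₂-shape₁ : ∀ j k → Y₂ (j +ℕ k) (suc k) ≡ hTerm j (suc k) (suc (j +ℕ 2 *ℕ k)) j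
  Y₂-shape₁ j k = cong₂ (λ n a → hTerm n (suc k) a n) (ℕ.m+n∸n≡m j k) (shape j k)
    where
    shape : ∀ j k → j +ℕ k +ℕ suc k ≡ suc (j +ℕ 2 *ℕ k)
    shape = ℕ-solve-∀

  y₂Num₀ y₂Num₁ : ℤ → ℤ → ℤ
  y₂Num₀ j k = + 2 * (+ 1 + + 2 * j) * (+ 2 * (k * k * k))
  y₂Num₁ j k = + 2 * (+ 1 + j + + 2 * k) * (+ 1 + j) * (+ 1 + j - k) * (j - k)

  Y₂-ratio₀ : ∀ j k → hDen (+ j) (+ k) · (+ k * + k) * hTerm (suc j) k (j +ℕ 2 *ℕ k) (suc j) ≐ y₂Num₀ (+ j) (+ k) · hℤ (suc j) k
  Y₂-ratio₀ j k = ≐-rescale (+ 2 * (+ 1 + + 2 * + j)) (+ 1) (denominators (+ j) (+ k)) (numerators (+ j) (+ k))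
    (≐-*ˡ (+ k * + k) (≐-* (≐-* (≐-* (≐-refl {+ 1} {+ ((2 *ℕ suc j) C suc j)}) (≐-refl {+ 1} {+ ((2 *ℕ k) C k)})) third)
                                 (≐-refl {+ 1} {+ (suc j C k)})))
    where
    third : (+ 1 + (+ j + + 2 * + k)) · + ((j +ℕ 2 *ℕ k) C suc j) ≐ (+ 1 + (+ j + + 2 * + k) - + suc j) · + (suc (j +ℕ 2 *ℕ k) C suc j)
    third = ≐-cong (cong (λ p → + 1 + p) (pos-+2* j k)) refl (cong (λ p → + 1 + p - + suc j) (pos-+2* j k)) refl
                   (C-ratio-top (j +ℕ 2 *ℕ k) (suc j))
    denominators : ∀ j k → + 2 * (+ 1 + + 2 * j) * (+ 1 * + 1 * (+ 1 + (j + + 2 * k)) * + 1) ≡ + 1 * (+ 2 * (+ 1 + + 2 * j) * (+ 1 + j + + 2 * k))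
    denominators = solve-∀
    numerators : ∀ j k → + 2 * (+ 1 + + 2 * j) * ((k * k) * (+ 1 * + 1 * (+ 1 + (j + + 2 * k) - (+ 1 + j)) * + 1))
                  ≡ + 1 * (+ 2 * (+ 1 + + 2 * j) * (+ 2 * (k * k * k)))
    numerators = solve-∀

  Y₂-ratio₁ : ∀ j k → hDen (+ j) (+ k) · (+ suc k * + suc k) * hTerm j (suc k) (suc (j +ℕ 2 *ℕ k)) j ≐ y₂Num₁ (+ j) (+ k) · hℤ (suc j) k
  Y₂-ratio₁ j k = ≐-rescale (+ 1 + + j + + 2 * + k) scale {{nonZero-scale}} (denominators (+ j) (+ k)) (numerators (+ j) (+ k))
    (≐-*ˡ (+ suc k * + suc k) (≐-* (≐-* (≐-* (C-ratio-central j) (≐-sym (C-ratio-central k))) third) fourth))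
    where
    N = j +ℕ 2 *ℕ k
    scale = (+ 1 + + j) * (+ 1 + + 2 * + k) * (+ 1 + + k) * (+ 1 + + k)
    nonZero-scale : NonZero scale
    nonZero-scale = ℤ.i*j≢0 ((+ 1 + + j) * (+ 1 + + 2 * + k) * (+ 1 + + k)) (+ 1 + + k)
                  {{ℤ.i*j≢0 ((+ 1 + + j) * (+ 1 + + 2 * + k)) (+ 1 + + k)
                    {{ℤ.i*j≢0 (+ 1 + + j) (+ 1 + + 2 * + k) {{_}} {{nonZero-odd k}}}}}}
    third : (+ 1 + (+ j + + 2 * + k) - + j) · + (suc N C j) ≐ (+ 1 + + j) · + (suc N C suc j)
    third = ≐-cong (cong (λ p → + 1 + p - + j) (pos-+2* j k)) refl refl refl (≐-sym (C-ratio-bottom (suc N) j))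
    fourth = ≐-trans (C-ratio-bottom j k) (C-ratio-top j k)
    denominators : ∀ j k → (+ 1 + j + + 2 * k) * (+ 2 * (+ 1 + + 2 * j) * (+ 1 + k) * (+ 1 + (j + + 2 * k) - j) * ((+ 1 + k) * (+ 1 + j)))
                  ≡ (+ 1 + j) * (+ 1 + + 2 * k) * (+ 1 + k) * (+ 1 + k) * (+ 2 * (+ 1 + + 2 * j) * (+ 1 + j + + 2 * k))
    denominators = solve-∀
    numerators : ∀ j k → (+ 1 + j + + 2 * k) * ((+ 1 + k) * (+ 1 + k) * ((+ 1 + j) * (+ 2 * (+ 1 + + 2 * k)) * (+ 1 + j) * ((j - k) * (+ 1 + j - k))))
                  ≡ (+ 1 + j) * (+ 1 + + 2 * k) * (+ 1 + k) * (+ 1 + k) * (+ 2 * (+ 1 + j + + 2 * k) * (+ 1 + j) * (+ 1 + j - k) * (j - k))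
    numerators = solve-∀

  G₂ : ℕ → ℕ → ℤ
  G₂ m k = + 3 * ((+ k * + k) * Y₂ m k)

  G₂-top : ∀ m → G₂ m (suc m) ≡ + 0
  G₂-top m = trans (cong (λ y → + 3 * ((+ suc m * + suc m) * y)) vanish) (cong (+ 3 *_) (ℤ.*-zeroʳ (+ suc m * + suc m)))
    where
    vanish : Y₂ m (suc m) ≡ + 0
    vanish = hTerm-vanishes (m ∸ m) (suc m) (m +ℕ suc m) (m ∸ m) (subst (_< suc m) (sym (ℕ.n∸n≡0 m)) (s≤s z≤n))

  FirstOrderStep : ℕ → ℕ → Set
  FirstOrderStep m k =
    (+ 1 + + m) * ((+ 2 * + m + + 2 - + 5 * + k) * h-antidiagonal (suc m) k - (+ 2 * + m + + 4 + + 10 * + k) * h-antidiagonal m k)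
    ≡ G₂ m (suc k) - G₂ m k

  firstOrder-step : ∀ j k → FirstOrderStep (j +ℕ k) k
  firstOrder-step j k = begin
    c * (α * h-antidiagonal (suc m) k - β * h-antidiagonal m k)
      ≡⟨ cong₂ (λ a b → c * (α * a - β * b)) (on-row (suc j)) (on-row j) ⟩
    c * (α * hℤ (suc j) k - β * hℤ j k)
      ≡⟨ ≐-unique {{nonZero-hDen j k}} lhs rhs (identity (+ j) (+ k)) ⟩
    G₂ m (suc k) - G₂ m k
      ∎
    where
    m = j +ℕ k
    c = + 1 + + m
    α = + 2 * + m + + 2 - + 5 * + k
    β = + 2 * + m + + 4 + + 10 * + k
    on-row : ∀ i → h-antidiagonal (i +ℕ k) k ≡ hℤ i k
    on-row i = cong (λ n → hℤ n k) (ℕ.m+n∸n≡m i k)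
    lhs = ≐-*ˡ c (≐-sub (≐-*ˡ α ≐-refl) (≐-*ˡ β (h-ratio j k)))
    rhs = ≐-sub (≐-*ˡ (+ 3) (≐-cong refl (cong (+ suc k * + suc k *_) (sym (Y₂-shape₁ j k))) refl refl (Y₂-ratio₁ j k)))
              (≐-*ˡ (+ 3) (≐-cong refl (cong (+ k * + k *_) (sym (Y₂-shape₀ j k))) refl refl (Y₂-ratio₀ j k)))
    identity : ∀ j k → (+ 1 + (j + k)) * ((+ 2 * (j + k) + + 2 - + 5 * k) * (+ 2 * (+ 1 + + 2 * j) * (+ 1 + j + + 2 * k)) - (+ 2 * (j + k) + + 4 + + 10 * k) * ((+ 1 + j) * (+ 1 + j - k)))
                      ≡ + 3 * (+ 2 * (+ 1 + j + + 2 * k) * (+ 1 + j) * (+ 1 + j - k) * (j - k)) - + 3 * (+ 2 * (+ 1 + + 2 * j) * (+ 2 * (k * k * k)))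
    identity = solve-∀

  firstOrder-telescopes : ∀ m → sumToℤ m (λ k → (+ 2 * + m + + 2 - + 5 * + k) * h-antidiagonal (suc m) k
                                       - (+ 2 * + m + + 4 + + 10 * + k) * h-antidiagonal m k) ≡ + 0
  firstOrder-telescopes m = telescoping-sum≡0 m (+ 1 + + m) _ (G₂ m) step refl (G₂-top m)
    where
    step : ∀ k → k ≤ m → FirstOrderStep m k
    step k k≤m = subst (λ n → FirstOrderStep n k) (ℕ.m∸n+n≡m k≤m) (firstOrder-step (m ∸ k) k)

  weightedRow : ℕ → ℤ
  weightedRow m = sumToℤ m (λ k → (+ m - + k) * h-antidiagonal m k)

  weightedRow-relation : ∀ m → + 5 * weightedRow (suc m) + + 10 * weightedRow m
                               ≡ + 3 * (+ suc m * rowSum h-antidiagonal (suc m)) + (+ 4 + + 12 * + m) * rowSum h-antidiagonal m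
  weightedRow-relation m = ℤ.i-j≡0⇒i≡j _ _ (begin
    + 5 * weightedRow (suc m) + + 10 * weightedRow m - (+ 3 * (+ suc m * rowSum A (suc m)) + γ * rowSum A m)
      ≡⟨ cong₂ (λ p q → + 5 * p + + 10 * S v - (+ 3 * (+ suc m * q) + γ * S b)) drop-u drop-a ⟩
    + 5 * S u + + 10 * S v - (+ 3 * (+ suc m * S a) + γ * S b)
      ≡⟨ cong (λ p → + 5 * S u + + 10 * S v - (+ 3 * p + γ * S b)) (sumToℤ-*ˡ m (+ suc m) a) ⟨
    + 5 * S u + + 10 * S v - (+ 3 * S (λ k → + suc m * a k) + γ * S b)
      ≡⟨ cong₂ _-_ (cong₂ _+_ (sumToℤ-*ˡ m (+ 5) u) (sumToℤ-*ˡ m (+ 10) v))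
                   (cong₂ _+_ (sumToℤ-*ˡ m (+ 3) (λ k → + suc m * a k)) (sumToℤ-*ˡ m γ b)) ⟨
    S (λ k → + 5 * u k) + S (λ k → + 10 * v k) - (S (λ k → + 3 * (+ suc m * a k)) + S (λ k → γ * b k))
      ≡⟨ cong₂ _-_ (sumToℤ-+ m _ _) (sumToℤ-+ m _ _) ⟨
    S (λ k → + 5 * u k + + 10 * v k) - S (λ k → + 3 * (+ suc m * a k) + γ * b k)
      ≡⟨ sumToℤ-sub m _ _ ⟨
    S (λ k → + 5 * u k + + 10 * v k - (+ 3 * (+ suc m * a k) + γ * b k))
      ≡⟨ sumToℤ-cong m (λ k _ → collect (+ m) (+ k) (a k) (b k)) ⟩
    S (λ k → (+ 2 * + m + + 2 - + 5 * + k) * a k - (+ 2 * + m + + 4 + + 10 * + k) * b k)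
      ≡⟨ firstOrder-telescopes m ⟩
    + 0 ∎)
    where
    A = h-antidiagonal
    S = sumToℤ m
    γ = + 4 + + 12 * + m
    u = λ k → (+ suc m - + k) * A (suc m) k
    v = λ k → (+ m - + k) * A m k
    a = A (suc m)
    b = A m
    top-vanishes : A (suc m) (suc m) ≡ + 0
    top-vanishes = h-antidiagonal-vanishes (suc m) (suc m) (n<n+n (suc m) (s≤s z≤n))
    drop-u : weightedRow (suc m) ≡ S u
    drop-u = sumToℤ-dropLast m u (trans (cong ((+ suc m - + suc m) *_) top-vanishes) (ℤ.*-zeroʳ (+ suc m - + suc m)))
    drop-a : rowSum A (suc m) ≡ S a
    drop-a = sumToℤ-dropLast m a top-vanishes
    collect : ∀ m k a b → + 5 * ((+ 1 + m - k) * a) + + 10 * ((m - k) * b) - (+ 3 * ((+ 1 + m) * a) + (+ 4 + + 12 * m) * b)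
                          ≡ (+ 2 * m + + 2 - + 5 * k) * a - (+ 2 * m + + 4 + + 10 * k) * b
    collect = solve-∀

  lin-⊛ : ∀ a b (s : Series) m → (lin a b ⊛ s) (suc m) ≡ a *ℕ s (suc m) +ℕ b *ℕ s m
  lin-⊛ a b s m = sumTo-support≤1 m (λ i → lin a b i *ℕ s (suc m ∸ i)) (λ _ → refl)

  pos-lin : ∀ a b x y → + (a *ℕ x +ℕ b *ℕ y) ≡ + a * + x + + b * + y
  pos-lin a b x y = trans (ℤ.pos-+ (a *ℕ x) (b *ℕ y)) (cong₂ _+_ (ℤ.pos-* a x) (ℤ.pos-* b y))

  pos-doubleSeries : ∀ g m → + doubleSeries g m ≡ sumToℤ m (λ k → + g (m ∸ k) k)
  pos-doubleSeries g m = trans (cong +_ (doubleSeries-antidiagonal g m)) (pos-sumTo m (λ k → g (m ∸ k) k))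

  rowSum-h-antidiagonal≡f : ∀ m → rowSum h-antidiagonal m ≡ + f m
  rowSum-h-antidiagonal≡f m = begin
    rowSum h-antidiagonal m   ≡⟨ solution-unique h-antidiagonal-solves binomial⁴-solves refl refl m ⟩
    rowSum binomial⁴ m        ≡⟨ f≡rowSum-binomial⁴ m ⟨
    + f m                     ∎

  doubleSeries-h≡f : ∀ m → doubleSeries h m ≡ f m
  doubleSeries-h≡f m = ℤ.+-injective (begin
    + doubleSeries h m        ≡⟨ pos-doubleSeries h m ⟩
    sumToℤ m (λ k → + h (m ∸ k) k)
                              ≡⟨ sumToℤ-cong m (λ k _ → pos-h (m ∸ k) k) ⟩
    rowSum h-antidiagonal m   ≡⟨ rowSum-h-antidiagonal≡f m ⟩
    + f m                     ∎)

  pos-doubleSeries-weighted : ∀ m → + doubleSeries (λ n k → n *ℕ h n k) m ≡ weightedRow m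
  pos-doubleSeries-weighted m = trans (pos-doubleSeries (λ n k → n *ℕ h n k) m) (sumToℤ-cong m term)
    where
    term : ∀ k → k ≤ m → + ((m ∸ k) *ℕ h (m ∸ k) k) ≡ (+ m - + k) * h-antidiagonal m k
    term k k≤m = trans (ℤ.pos-* (m ∸ k) _)
                       (cong₂ _*_ (sym (trans (ℤ.m-n≡m⊖n m k) (ℤ.⊖-≥ k≤m))) (pos-h (m ∸ k) k))

  derivative-identity : ∀ m → (lin 5 10 ⊛ doubleSeries (λ n k → n *ℕ h n k)) m ≡ ((lin 0 4 ⊛ f) ⊕ (lin 3 12 ⊛ D f)) m
  derivative-identity zero    = refl
  derivative-identity (suc m) = ℤ.+-injective (begin
    + (lin 5 10 ⊛ d) (suc m)
      ≡⟨ cong +_ (lin-⊛ 5 10 d m) ⟩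
    + (5 *ℕ d (suc m) +ℕ 10 *ℕ d m)
      ≡⟨ pos-lin 5 10 (d (suc m)) (d m) ⟩
    + 5 * + d (suc m) + + 10 * + d m
      ≡⟨ cong₂ (λ p q → + 5 * p + + 10 * q) (pos-doubleSeries-weighted (suc m)) (pos-doubleSeries-weighted m) ⟩
    + 5 * weightedRow (suc m) + + 10 * weightedRow m
      ≡⟨ weightedRow-relation m ⟩
    + 3 * (+ suc m * rowSum h-antidiagonal (suc m)) + (+ 4 + + 12 * + m) * rowSum h-antidiagonal m
      ≡⟨ cong₂ (λ p q → + 3 * (+ suc m * p) + (+ 4 + + 12 * + m) * q) (rowSum-h-antidiagonal≡f (suc m)) (rowSum-h-antidiagonal≡f m) ⟩
    + 3 * (+ suc m * + f (suc m)) + (+ 4 + + 12 * + m) * + f m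
      ≡⟨ regroup (+ suc m) (+ m) (+ f (suc m)) (+ f m) ⟩
    (+ 0 * + f (suc m) + + 4 * + f m) + (+ 3 * (+ suc m * + f (suc m)) + + 12 * (+ m * + f m))
      ≡⟨ cong₂ _+_ (pos-lin 0 4 (f (suc m)) (f m))
                   (trans (pos-lin 3 12 (D f (suc m)) (D f m))
                          (cong₂ (λ p q → + 3 * p + + 12 * q) (ℤ.pos-* (suc m) (f (suc m))) (ℤ.pos-* m (f m)))) ⟨
    + (0 *ℕ f (suc m) +ℕ 4 *ℕ f m) + + (3 *ℕ D f (suc m) +ℕ 12 *ℕ D f m)
      ≡⟨ ℤ.pos-+ (0 *ℕ f (suc m) +ℕ 4 *ℕ f m) _ ⟨
    + ((0 *ℕ f (suc m) +ℕ 4 *ℕ f m) +ℕ (3 *ℕ D f (suc m) +ℕ 12 *ℕ D f m))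
      ≡⟨ cong +_ (cong₂ _+ℕ_ (lin-⊛ 0 4 f m) (lin-⊛ 3 12 (D f) m)) ⟨
    + ((lin 0 4 ⊛ f) ⊕ (lin 3 12 ⊛ D f)) (suc m)
      ∎)
    where
    d = doubleSeries (λ n k → n *ℕ h n k)
    regroup : ∀ s m x y → + 3 * (s * x) + (+ 4 + + 12 * m) * y ≡ (+ 0 * x + + 4 * y) + (+ 3 * (s * x) + + 12 * (m * y))
    regroup = solve-∀

open import Defs
open import Data.Nat using (ℕ; _*_)
open import Data.Product using (_×_; _,_)
open import Relation.Binary.PropositionalEquality using (_≡_)
open Proof using (doubleSeries-h≡f; derivative-identity)

lemma2p3 : ((m : ℕ) → doubleSeries h m ≡ f m)
         × ((m : ℕ) → (lin 5 10 ⊛ doubleSeries (λ n k → n * h n k)) m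
                       ≡ ((lin 0 4 ⊛ f) ⊕ (lin 3 12 ⊛ D f)) m)
lemma2p3 = doubleSeries-h≡f , derivative-identity
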